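{- Let $G$ be a graph on a vertex set $V$ with a partition $V=V_1\cup V_2\cup V_3$ such that $|V_i|=n$ for each $i\in[3]$. If $G$ is cyclically triangle-free, then $|G|\le 5n^2/2+5n$.
   Context: $|G|$ denotes the number of edges. $G$ is cyclically triangle-free (with respect to the partition) if there is no $3$-set spanning a triangle in $G$ that has one vertex in each of $V_1,V_2,V_3$, or two vertices in $V_1$ and one in $V_2$, or two in $V_2$ and one in $V_3$, or two in $V_3$ and one in $V_1$. -}

module Defs where

open import Data.Nat using (ℕ; zero; suc; _+_; _*_; _<_)
open import Data.Nat.Properties using (_<?_)
open import Data.Fin using (Fin; toℕ)
open import Data.Fin.Properties using (_≟_)
open import Data.Product using (_×_; _,_; proj₁)
open import Data.Sum using (_⊎_)
open import Data.Bool using (Bool; true; false; if_then_else_)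
open import Data.List using (List; length; filter; allFin; cartesianProduct)
open import Relation.Binary.PropositionalEquality using (_≡_)
open import Relation.Nullary using (¬_; Dec; yes; no)

-- Vertex set V = V₁ ∪ V₂ ∪ V₃ with |Vᵢ| = n, realised as Fin 3 × Fin n:
-- the vertex (i , j) is the j-th vertex of the part V_{i+1}.
Vertex : ℕ → Set
Vertex n = Fin 3 × Fin n

part : ∀ {n} → Vertex n → Fin 3
part = proj₁

record Graph (n : ℕ) : Set where
  field
    adj   : Vertex n → Vertex n → Bool
    sym   : ∀ u v → adj u v ≡ adj v u
    irrefl : ∀ v → adj v v ≡ false
open Graph public

next : Fin 3 → Fin 3
next Fin.zero = Fin.suc Fin.zero
next (Fin.suc Fin.zero) = Fin.suc (Fin.suc Fin.zero)
next (Fin.suc (Fin.suc Fin.zero)) = Fin.zero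

CyclicType : Fin 3 → Fin 3 → Fin 3 → Set
CyclicType a b c =
  (¬ a ≡ b × ¬ b ≡ c × ¬ a ≡ c)
  ⊎ (a ≡ b × c ≡ next a)
  ⊎ (a ≡ c × b ≡ next a)
  ⊎ (b ≡ c × a ≡ next b)

CyclicallyTriangleFree : ∀ {n} → Graph n → Set
CyclicallyTriangleFree {n} G =
  ∀ (x y z : Vertex n) →
    adj G x y ≡ true → adj G y z ≡ true → adj G x z ≡ true →
    ¬ CyclicType (part x) (part y) (part z)

code : ∀ {n} → Vertex n → ℕ
code {n} (i , j) = toℕ i * n + toℕ j

allVertices : (n : ℕ) → List (Vertex n)
allVertices n = cartesianProduct (allFin 3) (allFin n)

isEdge : ∀ {n} → Graph n → Vertex n × Vertex n → Bool
isEdge G (u , v) with code u <? code v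
... | yes _ = adj G u v
... | no _ = false

-- |G| : the number of edges, i.e. pairs {u , v} with u adjacent to v,
-- each counted once (as the ordered pair with code u < code v).
numEdges : ∀ {n} → Graph n → ℕ
numEdges {n} G =
  length (filter (λ p → Data.Bool._≟_ (isEdge G p) true)
                 (cartesianProduct (allVertices n) (allVertices n)))

module Submission where

open import Defs hiding (sym)
open import Data.Nat using (ℕ; zero; suc; _+_; _*_; _≤_; _<_; z≤n; s≤s)
open import Data.Nat.Properties
open import Data.Fin using (Fin; zero; suc)
open import Data.Fin.Patterns using (0F; 1F; 2F)
import Data.Fin.Properties as Fin
open import Data.Bool using (Bool; true; false; _∧_; not)
import Data.Bool as Bool
open import Data.Product using (∃; ∃-syntax; _×_; _,_; proj₁; proj₂)
open import Data.Sum using (_⊎_; inj₁; inj₂)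
open import Data.Empty using (⊥; ⊥-elim)
open import Function using (_∘_)
open import Relation.Binary.PropositionalEquality hiding (J)
open import Relation.Nullary using (¬_; yes; no; does)
open import Relation.Nullary.Decidable using (_×-dec_)
open import Algebra.Properties.Semiring.Sum +-*-semiring
  using (sum; sum-syntax; ∑-distrib-+; ∑-comm; sum-cong-≗; *-distribˡ-sum)
open import Data.Nat.Tactic.RingSolver
open import Data.List using (List; []; _∷_; length; filter; map; _++_; tabulate; allFin; cartesianProduct)
open import Data.List.Extrema.Nat using (argmin; argmin-sel; f[argmin]≤f[xs])
open import Data.List.Membership.Propositional.Properties using (∈-filter⁺; ∈-filter⁻; ∈-allFin)
import Data.List.Relation.Unary.All as All
open import Relation.Unary using (Pred; Decidable)

-- Call a vertex set s balanced if it meets every part in exactly k vertices. By induction on k,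
-- the number of ordered adjacent pairs inside a balanced s is at most 5k² + 10k: it suffices to
-- find one vertex of s in each part with s-degrees summing to at most 5k, and to delete them.
-- Take a vertex of minimum s-degree in each part. A forbidden triangle is exactly what two
-- adjacent vertices with a suitable common neighbour would form, so for an edge from V_p to
-- V_{p+1} the two endpoints have disjoint neighbourhoods in V_p and in V_{p+2}, and two adjacent
-- vertices of V_p have disjoint neighbourhoods in V_{p+1}. Hence the degrees along an edge or
-- along a path through the three parts sum to 3k plus a few leftover terms. If some vertex has
-- no neighbour in the next part, a short case analysis bounds the sum of the minimum degrees by
-- 5k; otherwise we walk forward V₀ → V₁ → V₂ → V₀ from a suitable vertex, and the three
-- resulting inequalities telescope to the same bound.

𝟙 : Bool → ℕ
𝟙 true = 1
𝟙 false = 0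

𝟙≤1 : ∀ b → 𝟙 b ≤ 1
𝟙≤1 true = ≤-refl
𝟙≤1 false = z≤n

𝟙-∧-split : ∀ a b c d e → 𝟙 (a ∧ b ∧ c) ≤ 𝟙 ((a ∧ not d) ∧ (b ∧ not e) ∧ c) + (𝟙 d * 𝟙 (b ∧ c) + 𝟙 e * 𝟙 (a ∧ c))
𝟙-∧-split false b c d e = z≤n
𝟙-∧-split true false c d e = z≤n
𝟙-∧-split true true false d e = z≤n
𝟙-∧-split true true true true e = s≤s z≤n
𝟙-∧-split true true true false true = ≤-refl
𝟙-∧-split true true true false false = ≤-refl

sum-mono-≤ : ∀ {n} {f g : Fin n → ℕ} → (∀ i → f i ≤ g i) → sum f ≤ sum g
sum-mono-≤ {zero} f≤g = z≤n
sum-mono-≤ {suc n} f≤g = +-mono-≤ (f≤g zero) (sum-mono-≤ (f≤g ∘ suc))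

≤-sum : ∀ {n} (f : Fin n → ℕ) i → f i ≤ sum f
≤-sum f zero = m≤m+n (f zero) _
≤-sum f (suc i) = ≤-trans (≤-sum (f ∘ suc) i) (m≤n+m _ (f zero))

sum-pos⇒∃ : ∀ {n} (f : Fin n → ℕ) → 0 < sum f → ∃[ i ] 0 < f i
sum-pos⇒∃ {suc n} f 0<∑ with f zero in f₀≡
... | suc _ = zero , subst (0 <_) (sym f₀≡) (s≤s z≤n)
... | zero with sum-pos⇒∃ (f ∘ suc) 0<∑
... | i , 0<fi = suc i , 0<fi

sum-const-1 : ∀ n → ∑[ i < n ] 1 ≡ n
sum-const-1 zero = refl
sum-const-1 (suc n) = cong suc (sum-const-1 n)

sum-zero : ∀ n → ∑[ i < n ] 0 ≡ 0
sum-zero zero = refl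
sum-zero (suc n) = sum-zero n

zero-or-pos : ∀ m → m ≡ 0 ⊎ 0 < m
zero-or-pos zero = inj₁ refl
zero-or-pos (suc m) = inj₂ (s≤s z≤n)

sum-select : ∀ {n} (i : Fin n) (f : Fin n → ℕ) → ∑[ j < n ] (𝟙 (does (j Fin.≟ i)) * f j) ≡ f i
sum-select {suc n} zero f = begin
  f zero + 0 + ∑[ j < n ] 0  ≡⟨ cong (f zero + 0 +_) (sum-zero n) ⟩
  f zero + 0 + 0             ≡⟨ +-identityʳ _ ⟩
  f zero + 0                 ≡⟨ +-identityʳ _ ⟩
  f zero                     ∎
  where open ≡-Reasoning
sum-select {suc n} (suc i) f = sum-select i (f ∘ suc)

cyclic-telescope : ∀ d₀ d₁ d₂ K b₀ b₁ b₂ b₃ →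
                   d₀ + d₀ + d₁ + b₁ ≤ K + b₀ → d₁ + d₁ + d₂ + b₂ ≤ K + b₁ → d₂ + d₂ + d₀ + b₃ ≤ K + b₂ →
                   b₀ ≤ b₃ → d₀ + d₁ + d₂ ≤ K
cyclic-telescope d₀ d₁ d₂ K b₀ b₁ b₂ b₃ h₁ h₂ h₃ b₀≤b₃ = *-cancelˡ-≤ 3 (+-cancelʳ-≤ b₃ _ _ (begin
  3 * (d₀ + d₁ + d₂) + b₃  ≤⟨ +-cancelˡ-≤ (b₁ + b₂) _ _ (begin
    (b₁ + b₂) + (3 * (d₀ + d₁ + d₂) + b₃)                               ≡⟨ lhs d₀ d₁ d₂ b₁ b₂ b₃ ⟩
    (d₀ + d₀ + d₁ + b₁) + (d₁ + d₁ + d₂ + b₂) + (d₂ + d₂ + d₀ + b₃)     ≤⟨ +-mono-≤ (+-mono-≤ h₁ h₂) h₃ ⟩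
    (K + b₀) + (K + b₁) + (K + b₂)                                       ≡⟨ rhs K b₀ b₁ b₂ ⟩
    (b₁ + b₂) + (3 * K + b₀)                                             ∎) ⟩
  3 * K + b₀               ≤⟨ +-monoʳ-≤ (3 * K) b₀≤b₃ ⟩
  3 * K + b₃               ∎))
  where
  open ≤-Reasoning
  lhs : ∀ d₀ d₁ d₂ b₁ b₂ b₃ → (b₁ + b₂) + (3 * (d₀ + d₁ + d₂) + b₃)
                                ≡ (d₀ + d₀ + d₁ + b₁) + (d₁ + d₁ + d₂ + b₂) + (d₂ + d₂ + d₀ + b₃)
  lhs = solve-∀
  rhs : ∀ K b₀ b₁ b₂ → (K + b₀) + (K + b₁) + (K + b₂) ≡ (b₁ + b₂) + (3 * K + b₀)
  rhs = solve-∀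

argmin-satisfying : ∀ {n} {p} {P : Pred (Fin n) p} → Decidable P → (f : Fin n → ℕ) → ∃ P →
                    ∃[ i ] P i × (∀ j → P j → f i ≤ f j)
argmin-satisfying {n} {P = P} P? f (w , Pw) = i , Pi , minimal
  where
  candidates = filter P? (allFin n)
  i = argmin f w candidates

  Pi : P i
  Pi with argmin-sel f w candidates
  ... | inj₁ i≡w = subst P (sym i≡w) Pw
  ... | inj₂ i∈candidates = proj₂ (∈-filter⁻ P? {xs = allFin n} i∈candidates)

  minimal : ∀ j → P j → f i ≤ f j
  minimal j Pj = All.lookup (f[argmin]≤f[xs] w candidates) (∈-filter⁺ P? {xs = allFin n} (∈-allFin j) Pj)

record Cyclic (p q r : Fin 3) : Set where
  field
    p→q : next p ≡ q
    q→r : next q ≡ r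
    r→p : next r ≡ p
open Cyclic

rotate : ∀ {p q r} → Cyclic p q r → Cyclic q r p
rotate c = record { p→q = q→r c ; q→r = r→p c ; r→p = p→q c }

cyclic-next : ∀ p → Cyclic p (next p) (next (next p))
cyclic-next zero = record { p→q = refl ; q→r = refl ; r→p = refl }
cyclic-next (suc zero) = record { p→q = refl ; q→r = refl ; r→p = refl }
cyclic-next (suc (suc zero)) = record { p→q = refl ; q→r = refl ; r→p = refl }

c₀₁₂ : Cyclic 0F 1F 2F
c₀₁₂ = cyclic-next 0F

c₁₂₀ : Cyclic 1F 2F 0F
c₁₂₀ = rotate c₀₁₂

c₂₀₁ : Cyclic 2F 0F 1F
c₂₀₁ = rotate c₁₂₀

cyclic-distinct : ∀ {p q r} → Cyclic p q r → ¬ p ≡ q × ¬ q ≡ r × ¬ p ≡ r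
cyclic-distinct {zero} record { p→q = refl ; q→r = refl } = (λ ()) , (λ ()) , (λ ())
cyclic-distinct {suc zero} record { p→q = refl ; q→r = refl } = (λ ()) , (λ ()) , (λ ())
cyclic-distinct {suc (suc zero)} record { p→q = refl ; q→r = refl } = (λ ()) , (λ ()) , (λ ())

cyclic⇒CyclicType-pqp : ∀ {p q r} → Cyclic p q r → CyclicType p q p
cyclic⇒CyclicType-pqp c = inj₂ (inj₂ (inj₁ (refl , sym (p→q c))))

cyclic⇒CyclicType-ppq : ∀ {p q r} → Cyclic p q r → CyclicType p p q
cyclic⇒CyclicType-ppq c = inj₂ (inj₁ (refl , sym (p→q c)))

cyclic⇒CyclicType-pqr : ∀ {p q r} → Cyclic p q r → CyclicType p q r
cyclic⇒CyclicType-pqr c = inj₁ (cyclic-distinct c)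

sum₃-cyclic : ∀ {p q r} → Cyclic p q r → (f : Fin 3 → ℕ) → sum f ≡ f p + f q + f r
sum₃-cyclic {zero} record { p→q = refl ; q→r = refl } f = rearrange (f zero) (f (suc zero)) (f (suc (suc zero)))
  where
  rearrange : ∀ x y z → x + (y + (z + 0)) ≡ x + y + z
  rearrange = solve-∀
sum₃-cyclic {suc zero} record { p→q = refl ; q→r = refl } f = rearrange (f zero) (f (suc zero)) (f (suc (suc zero)))
  where
  rearrange : ∀ x y z → x + (y + (z + 0)) ≡ y + z + x
  rearrange = solve-∀
sum₃-cyclic {suc (suc zero)} record { p→q = refl ; q→r = refl } f = rearrange (f zero) (f (suc zero)) (f (suc (suc zero)))
  where
  rearrange : ∀ x y z → x + (y + (z + 0)) ≡ z + x + y
  rearrange = solve-∀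

∑V : ∀ {n} → (Vertex n → ℕ) → ℕ
∑V {n} f = ∑[ p < 3 ] ∑[ j < n ] f (p , j)

∑V-cong : ∀ {n} {f g : Vertex n → ℕ} → (∀ v → f v ≡ g v) → ∑V f ≡ ∑V g
∑V-cong f≗g = sum-cong-≗ λ p → sum-cong-≗ λ j → f≗g (p , j)

∑V-mono-≤ : ∀ {n} {f g : Vertex n → ℕ} → (∀ v → f v ≤ g v) → ∑V f ≤ ∑V g
∑V-mono-≤ f≤g = sum-mono-≤ λ p → sum-mono-≤ λ j → f≤g (p , j)

∑V-zero : ∀ {n} → ∑V {n} (λ _ → 0) ≡ 0
∑V-zero {n} = trans (sum-cong-≗ {3} λ _ → sum-zero n) (sum-zero 3)

∑V-distrib-+ : ∀ {n} (f g : Vertex n → ℕ) → ∑V (λ v → f v + g v) ≡ ∑V f + ∑V g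
∑V-distrib-+ {n} f g =
  trans (sum-cong-≗ λ p → ∑-distrib-+ (λ j → f (p , j)) (λ j → g (p , j)))
        (∑-distrib-+ (λ p → ∑[ j < n ] f (p , j)) (λ p → ∑[ j < n ] g (p , j)))

∑V-distribˡ-* : ∀ {n} c (f : Vertex n → ℕ) → ∑V (λ v → c * f v) ≡ c * ∑V f
∑V-distribˡ-* {n} c f =
  sym (trans (*-distribˡ-sum c (λ p → ∑[ j < n ] f (p , j)))
             (sum-cong-≗ λ p → *-distribˡ-sum c (λ j → f (p , j))))

∑V-comm : ∀ {n} (f : Vertex n → Vertex n → ℕ) → ∑V (λ v → ∑V (λ w → f v w)) ≡ ∑V (λ w → ∑V (λ v → f v w))
∑V-comm {n} f = begin
  ∑[ p < 3 ] ∑[ i < n ] ∑[ q < 3 ] ∑[ j < n ] f (p , i) (q , j)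
    ≡⟨ sum-cong-≗ (λ p → ∑-comm λ i q → ∑[ j < n ] f (p , i) (q , j)) ⟩
  ∑[ p < 3 ] ∑[ q < 3 ] ∑[ i < n ] ∑[ j < n ] f (p , i) (q , j)
    ≡⟨ sum-cong-≗ (λ p → sum-cong-≗ λ q → ∑-comm λ i j → f (p , i) (q , j)) ⟩
  ∑[ p < 3 ] ∑[ q < 3 ] ∑[ j < n ] ∑[ i < n ] f (p , i) (q , j)
    ≡⟨ ∑-comm (λ p q → ∑[ j < n ] ∑[ i < n ] f (p , i) (q , j)) ⟩
  ∑[ q < 3 ] ∑[ p < 3 ] ∑[ j < n ] ∑[ i < n ] f (p , i) (q , j)
    ≡⟨ sum-cong-≗ (λ q → ∑-comm λ p j → ∑[ i < n ] f (p , i) (q , j)) ⟩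
  ∑[ q < 3 ] ∑[ j < n ] ∑[ p < 3 ] ∑[ i < n ] f (p , i) (q , j)
    ∎
  where open ≡-Reasoning

VertexSet : ℕ → Set
VertexSet n = Vertex n → Bool

_∖_ : ∀ {n} → VertexSet n → VertexSet n → VertexSet n
(s ∖ e) v = s v ∧ not (e v)

transversal : ∀ {n} → (Fin 3 → Fin n) → VertexSet n
transversal J (q , j) = does (j Fin.≟ J q)

∑V-transversal : ∀ {n} (J : Fin 3 → Fin n) (f : Vertex n → ℕ) →
                 ∑V (λ v → 𝟙 (transversal J v) * f v) ≡ ∑[ q < 3 ] f (q , J q)
∑V-transversal J f = sum-cong-≗ λ q → sum-select (J q) (λ j → f (q , j))

module Degrees {n} (G : Graph n) where

  adj-sym : ∀ {u v} → adj G u v ≡ true → adj G v u ≡ true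
  adj-sym {u} {v} uv = trans (Graph.sym G v u) uv

  degIn : VertexSet n → Vertex n → Fin 3 → ℕ
  degIn s v q = ∑[ j < n ] 𝟙 (s (q , j) ∧ adj G v (q , j))

  deg : VertexSet n → Vertex n → ℕ
  deg s v = ∑V λ w → 𝟙 (s w ∧ adj G v w)

  partSize : VertexSet n → Fin 3 → ℕ
  partSize s q = ∑[ j < n ] 𝟙 (s (q , j))

  degIn≤partSize : ∀ s v q → degIn s v q ≤ partSize s q
  degIn≤partSize s v q = sum-mono-≤ λ j → 𝟙-∧≤ (s (q , j)) (adj G v (q , j))
    where
    𝟙-∧≤ : ∀ b c → 𝟙 (b ∧ c) ≤ 𝟙 b
    𝟙-∧≤ true c = 𝟙≤1 c
    𝟙-∧≤ false c = z≤n

  degIn-pos⇒neighbour : ∀ s v q → 0 < degIn s v q → ∃[ j ] s (q , j) ≡ true × adj G v (q , j) ≡ true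
  degIn-pos⇒neighbour s v q 0<d with sum-pos⇒∃ _ 0<d
  ... | j , 0<𝟙 = j , 𝟙-∧-pos (s (q , j)) (adj G v (q , j)) 0<𝟙
    where
    𝟙-∧-pos : ∀ b c → 0 < 𝟙 (b ∧ c) → b ≡ true × c ≡ true
    𝟙-∧-pos true true _ = refl , refl

  neighbour⇒degIn-pos : ∀ s v {q} j → s (q , j) ≡ true → adj G v (q , j) ≡ true → 0 < degIn s v q
  neighbour⇒degIn-pos s v {q} j sj vj = ≤-trans (≤-reflexive (cong₂ (λ b c → 𝟙 (b ∧ c)) (sym sj) (sym vj)))
                                                (≤-sum (λ t → 𝟙 (s (q , t) ∧ adj G v (q , t))) j)

  partSize-pos⇒member : ∀ s q → 0 < partSize s q → ∃[ j ] s (q , j) ≡ true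
  partSize-pos⇒member s q 0<size with sum-pos⇒∃ _ 0<size
  ... | j , 0<𝟙 = j , 𝟙-pos (s (q , j)) 0<𝟙
    where
    𝟙-pos : ∀ b → 0 < 𝟙 b → b ≡ true
    𝟙-pos true _ = refl

  partSize≡0⇒∉ : ∀ s q → partSize s q ≡ 0 → ∀ j → s (q , j) ≡ false
  partSize≡0⇒∉ s q size≡0 j with s (q , j) in sj
  ... | false = refl
  ... | true = ⊥-elim (n≮0 (≤-trans (subst (λ b → 𝟙 b ≤ partSize s q) sj (≤-sum (λ t → 𝟙 (s (q , t))) j))
                                    (≤-reflexive size≡0)))

  partSize-∖-transversal : ∀ s J k q → s (q , J q) ≡ true → partSize s q ≡ suc k →
                           partSize (s ∖ transversal J) q ≡ k
  partSize-∖-transversal s J k q J∈s size≡ = suc-injective (begin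
    suc (partSize (s ∖ e) q)                            ≡⟨ +-comm 1 _ ⟩
    partSize (s ∖ e) q + 1                              ≡⟨ cong (partSize (s ∖ e) q +_) (sum-select (J q) (λ _ → 1)) ⟨
    partSize (s ∖ e) q + ∑[ j < n ] (𝟙 (e (q , j)) * 1)  ≡⟨ ∑-distrib-+ (λ j → 𝟙 ((s ∖ e) (q , j))) _ ⟨
    ∑[ j < n ] (𝟙 ((s ∖ e) (q , j)) + 𝟙 (e (q , j)) * 1) ≡⟨ sum-cong-≗ split ⟩
    partSize s q                                        ≡⟨ size≡ ⟩
    suc k                                               ∎)
    where
    open ≡-Reasoning
    e = transversal J
    split : ∀ j → 𝟙 ((s ∖ e) (q , j)) + 𝟙 (e (q , j)) * 1 ≡ 𝟙 (s (q , j))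
    split j with j Fin.≟ J q
    ... | yes refl rewrite J∈s = refl
    ... | no _ = trans (+-identityʳ _) (cong 𝟙 (∧-true (s (q , j))))
      where
      ∧-true : ∀ b → b ∧ true ≡ b
      ∧-true true = refl
      ∧-true false = refl

  degIn-disjoint : ∀ s v w q →
    (∀ j → s (q , j) ≡ true → adj G v (q , j) ≡ true → adj G w (q , j) ≡ true → ⊥) →
    degIn s v q + degIn s w q ≤ partSize s q
  degIn-disjoint s v w q noCommon =
    ≤-trans (≤-reflexive (sym (∑-distrib-+ (λ j → 𝟙 (s (q , j) ∧ adj G v (q , j)))
                                         (λ j → 𝟙 (s (q , j) ∧ adj G w (q , j))))))
            (sum-mono-≤ pointwise)
    where
    pointwise : ∀ j → 𝟙 (s (q , j) ∧ adj G v (q , j)) + 𝟙 (s (q , j) ∧ adj G w (q , j)) ≤ 𝟙 (s (q , j))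
    pointwise j with s (q , j) in sj | adj G v (q , j) in vj | adj G w (q , j) in wj
    ... | false | _ | _ = z≤n
    ... | true | true | true = ⊥-elim (noCommon j sj vj wj)
    ... | true | true | false = ≤-refl
    ... | true | false | true = ≤-refl
    ... | true | false | false = z≤n

  cyclicallyTriangleFree⇒degIn-disjoint : CyclicallyTriangleFree G → ∀ s x y t →
    adj G x y ≡ true → CyclicType (part x) (part y) t →
    degIn s x t + degIn s y t ≤ partSize s t
  cyclicallyTriangleFree⇒degIn-disjoint ctf s x y t xy type =
    degIn-disjoint s x y t λ j _ xz yz → ctf x y (t , j) xy yz xz type

module Balanced {n} (G : Graph n) (ctf : CyclicallyTriangleFree G)
                (s : VertexSet n) (k : ℕ) (balanced : ∀ q → Degrees.partSize G s q ≡ k) where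

  open Degrees G

  degIn≤k : ∀ v q → degIn s v q ≤ k
  degIn≤k v q = ≤-trans (degIn≤partSize s v q) (≤-reflexive (balanced q))

  degIn-disjoint≤k : ∀ {x y t} → adj G x y ≡ true → CyclicType (part x) (part y) t →
                     degIn s x t + degIn s y t ≤ k
  degIn-disjoint≤k {x} {y} {t} xy type =
    ≤-trans (cyclicallyTriangleFree⇒degIn-disjoint ctf s x y t xy type) (≤-reflexive (balanced t))

  edge-deg-bound : ∀ {p q r} → Cyclic p q r → ∀ i j → adj G (p , i) (q , j) ≡ true →
                   deg s (p , i) + deg s (q , j) ≤ k + k + k + degIn s (p , i) q
  edge-deg-bound {p} {q} {r} c i j xy = begin
    deg s x + deg s y                ≡⟨ cong₂ _+_ (sum₃-cyclic c (degIn s x)) (sum₃-cyclic (rotate c) (degIn s y)) ⟩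
    (Ix + Fx + Bx) + (Iy + Fy + By)  ≡⟨ regroup Ix Fx Bx Iy Fy By ⟩
    (Ix + By) + (Bx + Fy) + Iy + Fx  ≤⟨ +-monoˡ-≤ Fx (+-mono-≤ (+-mono-≤ (degIn-disjoint≤k xy (cyclic⇒CyclicType-pqp c))
                                                                      (degIn-disjoint≤k xy (cyclic⇒CyclicType-pqr c)))
                                                            (degIn≤k y q)) ⟩
    k + k + k + Fx                   ∎
    where
    open ≤-Reasoning
    x = (p , i)
    y = (q , j)
    Ix = degIn s x p
    Fx = degIn s x q
    Bx = degIn s x r
    Iy = degIn s y q
    Fy = degIn s y r
    By = degIn s y p
    regroup : ∀ a₁ a₂ a₃ b₁ b₂ b₃ → (a₁ + a₂ + a₃) + (b₁ + b₂ + b₃) ≡ (a₁ + b₃) + (a₃ + b₂) + b₁ + a₂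
    regroup = solve-∀

  path-deg-bound : ∀ {p q r} → Cyclic p q r → ∀ i₁ i₂ i₃ →
                   adj G (p , i₁) (q , i₂) ≡ true → adj G (q , i₂) (r , i₃) ≡ true →
                   deg s (p , i₁) + deg s (q , i₂) + deg s (r , i₃)
                     ≤ k + k + k + (degIn s (p , i₁) q + degIn s (r , i₃) r + degIn s (r , i₃) p)
  path-deg-bound {p} {q} {r} c i₁ i₂ i₃ xm my = begin
    deg s x + deg s m + deg s y
      ≡⟨ cong₂ _+_ (cong₂ _+_ (sum₃-cyclic c (degIn s x)) (sum₃-cyclic (rotate c) (degIn s m)))
                   (sum₃-cyclic (rotate (rotate c)) (degIn s y)) ⟩
    (Ix + Fx + Bx) + (Im + Fm + Bm) + (Iy + Fy + By)
      ≡⟨ regroup Ix Fx Bx Im Fm Bm Iy Fy By ⟩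
    (Im + By) + (Bx + Fm) + (Ix + Bm) + (Fx + Iy + Fy)
      ≤⟨ +-monoˡ-≤ (Fx + Iy + Fy) (+-mono-≤ (+-mono-≤ (degIn-disjoint≤k my (cyclic⇒CyclicType-pqp (rotate c)))
                                                      (degIn-disjoint≤k xm (cyclic⇒CyclicType-pqr c)))
                                            (degIn-disjoint≤k xm (cyclic⇒CyclicType-pqp c))) ⟩
    k + k + k + (Fx + Iy + Fy)
      ∎
    where
    open ≤-Reasoning
    x = (p , i₁)
    m = (q , i₂)
    y = (r , i₃)
    Ix = degIn s x p
    Fx = degIn s x q
    Bx = degIn s x r
    Im = degIn s m q
    Fm = degIn s m r
    Bm = degIn s m p
    Iy = degIn s y r
    Fy = degIn s y p
    By = degIn s y q
    regroup : ∀ a₁ a₂ a₃ b₁ b₂ b₃ c₁ c₂ c₃ →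
              (a₁ + a₂ + a₃) + (b₁ + b₂ + b₃) + (c₁ + c₂ + c₃) ≡ (b₁ + c₃) + (a₃ + b₂) + (a₁ + b₃) + (a₂ + c₁ + c₂)
    regroup = solve-∀

  deg-without-forward : ∀ {p q r} → Cyclic p q r → ∀ i → degIn s (p , i) q ≡ 0 →
                        deg s (p , i) ≡ degIn s (p , i) p + degIn s (p , i) r
  deg-without-forward {p} {q} {r} c i F≡0 = begin
    deg s x                                  ≡⟨ sum₃-cyclic c (degIn s x) ⟩
    degIn s x p + degIn s x q + degIn s x r  ≡⟨ cong (λ F → degIn s x p + F + degIn s x r) F≡0 ⟩
    degIn s x p + 0 + degIn s x r            ≡⟨ cong (_+ degIn s x r) (+-identityʳ _) ⟩
    degIn s x p + degIn s x r                ∎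
    where
    open ≡-Reasoning
    x = (p , i)

  deg-without-backward : ∀ {p q r} → Cyclic p q r → ∀ i → degIn s (p , i) r ≡ 0 →
                         deg s (p , i) ≡ degIn s (p , i) p + degIn s (p , i) q
  deg-without-backward {p} {q} {r} c i B≡0 = begin
    deg s x                                  ≡⟨ sum₃-cyclic c (degIn s x) ⟩
    degIn s x p + degIn s x q + degIn s x r  ≡⟨ cong (degIn s x p + degIn s x q +_) B≡0 ⟩
    degIn s x p + degIn s x q + 0            ≡⟨ +-identityʳ _ ⟩
    degIn s x p + degIn s x q                ∎
    where
    open ≡-Reasoning
    x = (p , i)

  module MinimumDegrees (J : Fin 3 → Fin n) (J∈s : ∀ q → s (q , J q) ≡ true)
                        (J-minimal : ∀ q j → s (q , j) ≡ true → deg s (q , J q) ≤ deg s (q , j)) where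

    δ : Fin 3 → ℕ
    δ q = deg s (q , J q)

    ∑δ≤ : ∀ {p q r} → Cyclic p q r → ∀ i₁ i₂ i₃ → s (p , i₁) ≡ true → s (q , i₂) ≡ true → s (r , i₃) ≡ true →
          sum δ ≤ deg s (p , i₁) + deg s (q , i₂) + deg s (r , i₃)
    ∑δ≤ {p} {q} {r} c i₁ i₂ i₃ s₁ s₂ s₃ = begin
      sum δ          ≡⟨ sum₃-cyclic c δ ⟩
      δ p + δ q + δ r ≤⟨ +-mono-≤ (+-mono-≤ (J-minimal p i₁ s₁) (J-minimal q i₂ s₂)) (J-minimal r i₃ s₃) ⟩
      deg s (p , i₁) + deg s (q , i₂) + deg s (r , i₃) ∎
      where open ≤-Reasoning

    pair-deg-bound : ∀ {p q r} → Cyclic p q r →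
                     ∃[ j₁ ] ∃[ j₂ ] s (p , j₁) ≡ true × s (q , j₂) ≡ true × deg s (p , j₁) + deg s (q , j₂) ≤ k + k + k + k
    pair-deg-bound {p} {q} {r} c with zero-or-pos (degIn s (p , J p) q)
    ... | inj₂ 0<F with degIn-pos⇒neighbour s (p , J p) q 0<F
    ...   | z , z∈s , yz = J p , z , J∈s p , z∈s , ≤-trans (edge-deg-bound c (J p) z yz) (+-monoʳ-≤ (k + k + k) (degIn≤k (p , J p) q))
    pair-deg-bound {p} {q} {r} c | inj₁ Fy≡0 with zero-or-pos (degIn s (q , J q) p)
    ... | inj₂ 0<B with degIn-pos⇒neighbour s (q , J q) p 0<B
    ...   | y′ , y′∈s , zy′ = y′ , J q , y′∈s , J∈s q ,
            ≤-trans (edge-deg-bound c y′ (J q) (adj-sym zy′)) (+-monoʳ-≤ (k + k + k) (degIn≤k (p , y′) q))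
    pair-deg-bound {p} {q} {r} c | inj₁ Fy≡0 | inj₁ Bz≡0 = y , z , J∈s p , J∈s q , (begin
      deg s (p , y) + deg s (q , z)
        ≡⟨ cong₂ _+_ (deg-without-forward c y Fy≡0) (deg-without-backward (rotate c) z Bz≡0) ⟩
      (degIn s (p , y) p + degIn s (p , y) r) + (degIn s (q , z) q + degIn s (q , z) r)
        ≤⟨ +-mono-≤ (+-mono-≤ (degIn≤k (p , y) p) (degIn≤k (p , y) r)) (+-mono-≤ (degIn≤k (q , z) q) (degIn≤k (q , z) r)) ⟩
      (k + k) + (k + k)
        ≡⟨ regroup k ⟩
      k + k + k + k ∎)
      where
      open ≤-Reasoning
      y = J p
      z = J q
      regroup : ∀ x → (x + x) + (x + x) ≡ x + x + x + x
      regroup = solve-∀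

    sink-bound-isolated : ∀ {p q r} → Cyclic p q r → ∀ i → s (p , i) ≡ true →
                          degIn s (p , i) q ≡ 0 → degIn s (p , i) r ≡ 0 → sum δ ≤ 5 * k
    sink-bound-isolated {p} {q} {r} c i x∈s F≡0 B≡0 with pair-deg-bound (rotate c)
    ... | y , z , y∈s , z∈s , yz≤ = begin
      sum δ                                            ≤⟨ ∑δ≤ c i y z x∈s y∈s z∈s ⟩
      deg s (p , i) + deg s (q , y) + deg s (r , z)    ≡⟨ +-assoc (deg s (p , i)) _ _ ⟩
      deg s (p , i) + (deg s (q , y) + deg s (r , z))  ≤⟨ +-mono-≤ deg-x≤k yz≤ ⟩
      k + (k + k + k + k)                              ≡⟨ regroup k ⟩
      5 * k                                            ∎
      where
      open ≤-Reasoning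
      regroup : ∀ k → k + (k + k + k + k) ≡ 5 * k
      regroup = solve-∀
      deg-x≤k : deg s (p , i) ≤ k
      deg-x≤k = begin
        deg s (p , i)                            ≡⟨ deg-without-backward c i B≡0 ⟩
        degIn s (p , i) p + degIn s (p , i) q    ≡⟨ cong (degIn s (p , i) p +_) F≡0 ⟩
        degIn s (p , i) p + 0                    ≡⟨ +-identityʳ _ ⟩
        degIn s (p , i) p                        ≤⟨ degIn≤k (p , i) p ⟩
        k                                        ∎

    ∑δ≤backPath : ∀ {p q r} → Cyclic p q r → ∀ i u m → s (p , i) ≡ true → s (q , u) ≡ true → s (r , m) ≡ true →
                  adj G (q , u) (r , m) ≡ true → adj G (r , m) (p , i) ≡ true →
                  sum δ ≤ k + k + k + (k + degIn s (p , i) p + degIn s (p , i) q)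
    ∑δ≤backPath {p} {q} {r} c i u m x∈s u∈s m∈s um mx = begin
      sum δ                                          ≤⟨ ∑δ≤ c i u m x∈s u∈s m∈s ⟩
      deg s (p , i) + deg s (q , u) + deg s (r , m)  ≡⟨ rotate₃ (deg s (p , i)) (deg s (q , u)) (deg s (r , m)) ⟩
      deg s (q , u) + deg s (r , m) + deg s (p , i)  ≤⟨ path-deg-bound (rotate c) u m i um mx ⟩
      k + k + k + (degIn s (q , u) r + degIn s (p , i) p + degIn s (p , i) q)
        ≤⟨ +-monoʳ-≤ (k + k + k) (+-monoˡ-≤ (degIn s (p , i) q) (+-monoˡ-≤ (degIn s (p , i) p) (degIn≤k (q , u) r))) ⟩
      k + k + k + (k + degIn s (p , i) p + degIn s (p , i) q) ∎
      where
      open ≤-Reasoning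
      rotate₃ : ∀ a b c → a + b + c ≡ b + c + a
      rotate₃ = solve-∀

    sink-bound-forwardless : ∀ {p q r} → Cyclic p q r → ∀ i y t →
                             s (p , i) ≡ true → s (q , y) ≡ true → s (r , t) ≡ true →
                             degIn s (p , i) q ≡ 0 → degIn s (q , y) r ≡ 0 → degIn s (r , t) q ≡ 0 →
                             adj G (p , i) (r , t) ≡ true → sum δ ≤ 5 * k
    sink-bound-forwardless {p} {q} {r} c i y t x∈s y∈s t∈s Fx≡0 Fy≡0 Bt≡0 xt = begin
      sum δ                                              ≤⟨ ∑δ≤ c i y t x∈s y∈s t∈s ⟩
      deg s x + deg s (q , y) + deg s (r , t)
        ≡⟨ cong₂ _+_ (cong₂ _+_ (deg-without-forward c i Fx≡0) (deg-without-forward (rotate c) y Fy≡0))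
                     (deg-without-backward (rotate (rotate c)) t Bt≡0) ⟩
      (Ix + Bx) + (Iy + By) + (It + Ft)                  ≡⟨ regroup Ix Bx Iy By It Ft ⟩
      (It + Bx) + Ix + Iy + By + Ft
        ≤⟨ +-mono-≤ (+-mono-≤ (+-mono-≤ (+-mono-≤ (degIn-disjoint≤k (adj-sym xt) (cyclic⇒CyclicType-pqp (rotate (rotate c))))
                                                   (degIn≤k x p))
                                        (degIn≤k (q , y) q))
                              (degIn≤k (q , y) p))
                    (degIn≤k (r , t) p) ⟩
      k + k + k + k + k                                  ≡⟨ regroup-5k k ⟩
      5 * k                                              ∎
      where
      open ≤-Reasoning
      x = (p , i)
      Ix = degIn s x p
      Bx = degIn s x r
      Iy = degIn s (q , y) q
      By = degIn s (q , y) p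
      It = degIn s (r , t) r
      Ft = degIn s (r , t) p
      regroup : ∀ a₁ a₂ b₁ b₂ c₁ c₂ → (a₁ + a₂) + (b₁ + b₂) + (c₁ + c₂) ≡ (c₁ + a₂) + a₁ + b₁ + b₂ + c₂
      regroup = solve-∀
      regroup-5k : ∀ k → k + k + k + k + k ≡ 5 * k
      regroup-5k = solve-∀

    sink-bound-forwardEdge : ∀ {p q r} → Cyclic p q r → ∀ i y w →
                             s (p , i) ≡ true → s (q , y) ≡ true → s (r , w) ≡ true →
                             degIn s (p , i) q ≡ 0 → adj G (q , y) (r , w) ≡ true →
                             (∀ t → s (r , t) ≡ true → adj G (p , i) (r , t) ≡ true → degIn s (r , t) q ≡ 0) →
                             sum δ ≤ 5 * k
    sink-bound-forwardEdge {p} {q} {r} c i y w x∈s y∈s w∈s Fx≡0 yw noBackPath = begin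
      sum δ                                          ≤⟨ ∑δ≤ c i y w x∈s y∈s w∈s ⟩
      deg s x + deg s (q , y) + deg s (r , w)        ≡⟨ +-assoc (deg s x) _ _ ⟩
      deg s x + (deg s (q , y) + deg s (r , w))
        ≤⟨ +-mono-≤ (≤-reflexive (deg-without-forward c i Fx≡0)) (edge-deg-bound (rotate c) y w yw) ⟩
      (Ix + Bx) + (k + k + k + Fy)                   ≡⟨ regroup Ix Bx Fy k ⟩
      Ix + (Bx + Fy) + (k + k + k)                   ≤⟨ +-monoˡ-≤ (k + k + k) (+-mono-≤ (degIn≤k x p) Bx+Fy≤k) ⟩
      k + k + (k + k + k)                            ≡⟨ regroup-5k k ⟩
      5 * k                                          ∎
      where
      open ≤-Reasoning
      x = (p , i)
      Ix = degIn s x p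
      Bx = degIn s x r
      Fy = degIn s (q , y) r
      regroup : ∀ a₁ a₂ b k → (a₁ + a₂) + (k + k + k + b) ≡ a₁ + (a₂ + b) + (k + k + k)
      regroup = solve-∀
      regroup-5k : ∀ k → k + k + (k + k + k) ≡ 5 * k
      regroup-5k = solve-∀
      -- A common neighbour of x and y in V_r would be a backward neighbour of x with a backward neighbour y.
      Bx+Fy≤k : Bx + Fy ≤ k
      Bx+Fy≤k = ≤-trans (degIn-disjoint s x (q , y) r noCommon) (≤-reflexive (balanced r))
        where
        noCommon : ∀ t → s (r , t) ≡ true → adj G x (r , t) ≡ true → adj G (q , y) (r , t) ≡ true → ⊥
        noCommon t t∈s xt yt =
          <-irrefl (sym (noBackPath t t∈s xt)) (neighbour⇒degIn-pos s (r , t) y y∈s (adj-sym yt))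

    sink-bound-noBackPath : ∀ {p q r} → Cyclic p q r → ∀ i → s (p , i) ≡ true →
                            degIn s (p , i) q ≡ 0 → 0 < degIn s (p , i) r →
                            (∀ t → s (r , t) ≡ true → adj G (p , i) (r , t) ≡ true → degIn s (r , t) q ≡ 0) →
                            sum δ ≤ 5 * k
    sink-bound-noBackPath {p} {q} {r} c i x∈s Fx≡0 0<Bx noBackPath
      with degIn-pos⇒neighbour s (p , i) r 0<Bx
    ... | t , t∈s , xt with zero-or-pos (degIn s (q , J q) r)
    ...   | inj₁ Fy≡0 = sink-bound-forwardless c i (J q) t x∈s (J∈s q) t∈s Fx≡0 Fy≡0 (noBackPath t t∈s xt) xt
    ...   | inj₂ 0<Fy with degIn-pos⇒neighbour s (q , J q) r 0<Fy
    ...     | w , w∈s , yw = sink-bound-forwardEdge c i (J q) w x∈s (J∈s q) w∈s Fx≡0 yw noBackPath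

    sink-bound : ∀ {p q r} → Cyclic p q r → ∀ i → s (p , i) ≡ true → degIn s (p , i) q ≡ 0 → sum δ ≤ 5 * k
    sink-bound {p} {q} {r} c i x∈s Fx≡0 with zero-or-pos (degIn s (p , i) r)
    ... | inj₁ Bx≡0 = sink-bound-isolated c i x∈s Fx≡0 Bx≡0
    ... | inj₂ 0<Bx with Fin.any? (λ t → (s (r , t) Bool.≟ true) ×-dec (adj G (p , i) (r , t) Bool.≟ true)
                                          ×-dec (0 <? degIn s (r , t) q))
    ...   | yes (t , t∈s , xt , 0<Bt) with degIn-pos⇒neighbour s (r , t) q 0<Bt
    ...     | u , u∈s , tu = begin
      sum δ                                    ≤⟨ ∑δ≤backPath c i u t x∈s u∈s t∈s (adj-sym tu) (adj-sym xt) ⟩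
      k + k + k + (k + degIn s (p , i) p + degIn s (p , i) q)
        ≤⟨ +-monoʳ-≤ (k + k + k) (+-mono-≤ (+-monoʳ-≤ k (degIn≤k (p , i) p)) (≤-reflexive Fx≡0)) ⟩
      k + k + k + (k + k + 0)                  ≡⟨ regroup k ⟩
      5 * k                                    ∎
      where
      open ≤-Reasoning
      regroup : ∀ k → k + k + k + (k + k + 0) ≡ 5 * k
      regroup = solve-∀
    sink-bound {p} {q} {r} c i x∈s Fx≡0 | inj₂ 0<Bx | no noBackPath =
      sink-bound-noBackPath c i x∈s Fx≡0 0<Bx noBackPath′
      where
      noBackPath′ : ∀ t → s (r , t) ≡ true → adj G (p , i) (r , t) ≡ true → degIn s (r , t) q ≡ 0
      noBackPath′ t t∈s xt with zero-or-pos (degIn s (r , t) q)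
      ... | inj₁ Bt≡0 = Bt≡0
      ... | inj₂ 0<Bt = ⊥-elim (noBackPath (t , t∈s , xt , 0<Bt))

    NoSink : Set
    NoSink = ∀ {p q r} → Cyclic p q r → ∀ j → s (p , j) ≡ true → 0 < degIn s (p , j) q

    forward-step : NoSink → ∀ {p q r} → Cyclic p q r → ∀ i u m y →
                   s (p , i) ≡ true → s (q , u) ≡ true → s (r , m) ≡ true → s (q , y) ≡ true →
                   adj G (q , u) (r , m) ≡ true → adj G (r , m) (p , i) ≡ true → adj G (p , i) (q , y) ≡ true →
                   sum δ ≤ 5 * k ⊎ δ p + δ p + δ q + degIn s (q , y) p ≤ 5 * k + degIn s (p , i) r
    forward-step noSink {p} {q} {r} c i u m y x∈s u∈s m∈s y∈s um mx xy with zero-or-pos (degIn s (p , i) p)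
    ... | inj₁ Ix≡0 = inj₁ (begin
      sum δ                                    ≤⟨ ∑δ≤backPath c i u m x∈s u∈s m∈s um mx ⟩
      k + k + k + (k + degIn s (p , i) p + degIn s (p , i) q)
        ≤⟨ +-monoʳ-≤ (k + k + k) (+-mono-≤ (≤-reflexive (cong (k +_) Ix≡0)) (degIn≤k (p , i) q)) ⟩
      k + k + k + (k + 0 + k)                  ≡⟨ regroup k ⟩
      5 * k                                    ∎)
      where
      open ≤-Reasoning
      regroup : ∀ k → k + k + k + (k + 0 + k) ≡ 5 * k
      regroup = solve-∀
    ... | inj₂ 0<Ix with degIn-pos⇒neighbour s (p , i) p 0<Ix
    ...   | t , t∈s , xt with degIn-pos⇒neighbour s (p , t) q (noSink c t t∈s)
    ...     | w , w∈s , tw = inj₂ (begin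
      δ p + δ p + δ q + By
        ≤⟨ +-monoˡ-≤ By (+-mono-≤ (+-mono-≤ (J-minimal p i x∈s) (J-minimal p t t∈s)) (J-minimal q w w∈s)) ⟩
      deg s x + deg s (p , t) + deg s (q , w) + By
        ≡⟨ cong (_+ By) (+-assoc (deg s x) _ _) ⟩
      deg s x + (deg s (p , t) + deg s (q , w)) + By
        ≤⟨ +-monoˡ-≤ By (+-mono-≤ (≤-reflexive (sum₃-cyclic c (degIn s x))) (edge-deg-bound c t w tw)) ⟩
      (Ix + Fx + Bx) + (k + k + k + Ft) + By
        ≡⟨ regroup Ix Fx Bx k Ft By ⟩
      (Ix + By) + (Fx + Ft) + (k + k + k) + Bx
        ≤⟨ +-monoˡ-≤ Bx (+-monoˡ-≤ (k + k + k) (+-mono-≤ (degIn-disjoint≤k xy (cyclic⇒CyclicType-pqp c))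
                                                          (degIn-disjoint≤k xt (cyclic⇒CyclicType-ppq c)))) ⟩
      k + k + (k + k + k) + Bx
        ≡⟨ cong (_+ Bx) (regroup-5k k) ⟩
      5 * k + Bx ∎)
      where
      open ≤-Reasoning
      x = (p , i)
      Ix = degIn s x p
      Fx = degIn s x q
      Bx = degIn s x r
      Ft = degIn s (p , t) q
      By = degIn s (q , y) p
      regroup : ∀ a₁ a₂ a₃ k b c → (a₁ + a₂ + a₃) + (k + k + k + b) + c ≡ (a₁ + c) + (a₂ + b) + (k + k + k) + a₃
      regroup = solve-∀
      regroup-5k : ∀ k → k + k + (k + k + k) ≡ 5 * k
      regroup-5k = solve-∀

    module _ (noSink : NoSink) where

      forward : ∀ {p q r} → Cyclic p q r → ∀ j → s (p , j) ≡ true → ∃[ t ] s (q , t) ≡ true × adj G (p , j) (q , t) ≡ true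
      forward {p} {q} c j j∈s = degIn-pos⇒neighbour s (p , j) q (noSink c j j∈s)

      EndsForwardPath : Fin n → Set
      EndsForwardPath j = s (0F , j) ≡ true ×
        ∃[ m ] s (2F , m) ≡ true × adj G (0F , j) (2F , m) ≡ true × 0 < degIn s (2F , m) 1F

      endsForwardPath? : Decidable EndsForwardPath
      endsForwardPath? j = (s (0F , j) Bool.≟ true) ×-dec Fin.any? λ m →
        (s (2F , m) Bool.≟ true) ×-dec (adj G (0F , j) (2F , m) Bool.≟ true) ×-dec (0 <? degIn s (2F , m) 1F)

      endsForwardPath : ∀ {a m j} → s (1F , a) ≡ true → s (2F , m) ≡ true → s (0F , j) ≡ true →
                        adj G (1F , a) (2F , m) ≡ true → adj G (2F , m) (0F , j) ≡ true → EndsForwardPath j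
      endsForwardPath {a} {m} {j} a∈s m∈s j∈s am mj =
        j∈s , m , m∈s , adj-sym mj , neighbour⇒degIn-pos s (2F , m) a a∈s (adj-sym am)

      -- x₃ minimises the backward degree among endpoints of forward paths V₁ → V₂ → V₀; walking
      -- forward from x₃ three times ends at such an endpoint x₆, so the three forward-steps telescope.
      noSink-bound : sum δ ≤ 5 * k
      noSink-bound with forward c₁₂₀ (J 1F) (J∈s 1F)
      ... | m , m∈s , am with forward c₂₀₁ m m∈s
      ... | j , j∈s , mj
        with argmin-satisfying endsForwardPath? (λ j → degIn s (0F , j) 2F) (j , endsForwardPath (J∈s 1F) m∈s j∈s am mj)
      ... | x₃ , (x₃∈s , m₃ , m₃∈s , x₃m₃ , 0<Bm₃) , x₃-minimal
        with degIn-pos⇒neighbour s (2F , m₃) 1F 0<Bm₃ | forward c₀₁₂ x₃ x₃∈s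
      ... | a₃ , a₃∈s , m₃a₃ | x₄ , x₄∈s , x₃x₄ with forward c₁₂₀ x₄ x₄∈s
      ... | x₅ , x₅∈s , x₄x₅ with forward c₂₀₁ x₅ x₅∈s
      ... | x₆ , x₆∈s , x₅x₆
        with forward-step noSink c₀₁₂ x₃ a₃ m₃ x₄ x₃∈s a₃∈s m₃∈s x₄∈s (adj-sym m₃a₃) (adj-sym x₃m₃) x₃x₄
           | forward-step noSink c₁₂₀ x₄ m₃ x₃ x₅ x₄∈s m₃∈s x₃∈s x₅∈s (adj-sym x₃m₃) x₃x₄ x₄x₅
           | forward-step noSink c₂₀₁ x₅ x₃ x₄ x₆ x₅∈s x₃∈s x₄∈s x₆∈s x₃x₄ x₄x₅ x₅x₆
      ... | inj₁ done | _ | _ = done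
      ... | inj₂ _ | inj₁ done | _ = done
      ... | inj₂ _ | inj₂ _ | inj₁ done = done
      ... | inj₂ step₀ | inj₂ step₁ | inj₂ step₂ = begin
        sum δ              ≡⟨ sum₃-cyclic c₀₁₂ δ ⟩
        δ 0F + δ 1F + δ 2F ≤⟨ cyclic-telescope (δ 0F) (δ 1F) (δ 2F) (5 * k) _ _ _ _ step₀ step₁ step₂
                                (x₃-minimal x₆ (endsForwardPath x₄∈s x₅∈s x₆∈s x₄x₅ x₅x₆)) ⟩
        5 * k              ∎
        where open ≤-Reasoning

    ∑δ≤5k : sum δ ≤ 5 * k
    ∑δ≤5k with Fin.any? (λ p → Fin.any? λ j → (s (p , j) Bool.≟ true) ×-dec (degIn s (p , j) (next p) ≟ 0))
    ... | yes (p , j , j∈s , F≡0) = sink-bound (cyclic-next p) j j∈s F≡0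
    ... | no noSinkAnywhere = noSink-bound noSink
      where
      noSink : NoSink
      noSink {p} c j j∈s = n≢0⇒n>0 λ F≡0 →
        noSinkAnywhere (p , j , j∈s , subst (λ q → degIn s (p , j) q ≡ 0) (sym (p→q c)) F≡0)

  low-degree-transversal : 0 < k → ∃[ J ] (∀ q → s (q , J q) ≡ true) × ∑[ q < 3 ] deg s (q , J q) ≤ 5 * k
  low-degree-transversal 0<k = J , J∈s , MinimumDegrees.∑δ≤5k J J∈s J-minimal
    where
    member : ∀ q → ∃[ j ] s (q , j) ≡ true
    member q = partSize-pos⇒member s q (subst (0 <_) (sym (balanced q)) 0<k)

    minDegVertex : ∀ q → ∃[ j ] s (q , j) ≡ true × (∀ j′ → s (q , j′) ≡ true → deg s (q , j) ≤ deg s (q , j′))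
    minDegVertex q = argmin-satisfying (λ j → s (q , j) Bool.≟ true) (λ j → deg s (q , j)) (member q)

    J : Fin 3 → Fin n
    J q = proj₁ (minDegVertex q)

    J∈s : ∀ q → s (q , J q) ≡ true
    J∈s q = proj₁ (proj₂ (minDegVertex q))

    J-minimal : ∀ q j → s (q , j) ≡ true → deg s (q , J q) ≤ deg s (q , j)
    J-minimal q = proj₂ (proj₂ (minDegVertex q))

module Pairs {n} (G : Graph n) where

  open Degrees G

  adjacentPairs : VertexSet n → ℕ
  adjacentPairs s = ∑V λ v → ∑V λ w → 𝟙 (s v ∧ s w ∧ adj G v w)


  adjacentPairs-∖ : ∀ s e → adjacentPairs s ≤ adjacentPairs (s ∖ e) + 2 * ∑V (λ v → 𝟙 (e v) * deg s v)
  adjacentPairs-∖ s e = begin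
    adjacentPairs s
      ≤⟨ ∑V-mono-≤ (λ v → ∑V-mono-≤ λ w → pointwise v w) ⟩
    ∑V (λ v → ∑V λ w → P′ v w + (E v w + E w v))
      ≡⟨ ∑V-cong (λ v → trans (∑V-distrib-+ (P′ v) (λ w → E v w + E w v))
                             (cong (∑V (P′ v) +_) (∑V-distrib-+ (E v) (λ w → E w v)))) ⟩
    ∑V (λ v → ∑V (P′ v) + (∑V (E v) + ∑V (λ w → E w v)))
      ≡⟨ trans (∑V-distrib-+ (λ v → ∑V (P′ v)) (λ v → ∑V (E v) + ∑V (λ w → E w v)))
               (cong (adjacentPairs (s ∖ e) +_) (∑V-distrib-+ (λ v → ∑V (E v)) (λ v → ∑V (λ w → E w v)))) ⟩
    adjacentPairs (s ∖ e) + (M + ∑V (λ v → ∑V λ w → E w v))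
      ≡⟨ cong (λ M′ → adjacentPairs (s ∖ e) + (M + M′)) (∑V-comm (λ v w → E w v)) ⟩
    adjacentPairs (s ∖ e) + (M + M)
      ≡⟨ cong (λ M′ → adjacentPairs (s ∖ e) + (M + M′)) (+-identityʳ M) ⟨
    adjacentPairs (s ∖ e) + 2 * M
      ≡⟨ cong (λ M′ → adjacentPairs (s ∖ e) + 2 * M′) (∑V-cong λ v → ∑V-distribˡ-* (𝟙 (e v)) (λ w → 𝟙 (s w ∧ adj G v w))) ⟩
    adjacentPairs (s ∖ e) + 2 * ∑V (λ v → 𝟙 (e v) * deg s v)
      ∎
    where
    open ≤-Reasoning
    P′ : Vertex n → Vertex n → ℕ
    P′ v w = 𝟙 ((s ∖ e) v ∧ (s ∖ e) w ∧ adj G v w)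
    E : Vertex n → Vertex n → ℕ
    E v w = 𝟙 (e v) * 𝟙 (s w ∧ adj G v w)
    M : ℕ
    M = ∑V (λ v → ∑V (E v))
    pointwise : ∀ v w → 𝟙 (s v ∧ s w ∧ adj G v w) ≤ P′ v w + (E v w + E w v)
    pointwise v w = subst (λ b → 𝟙 (s v ∧ s w ∧ adj G v w) ≤ P′ v w + (E v w + 𝟙 (e w) * 𝟙 (s v ∧ b)))
                          (Graph.sym G v w) (𝟙-∧-split (s v) (s w) (adj G v w) (e v) (e w))

  adjacentPairs-balanced-bound : CyclicallyTriangleFree G → ∀ k s → (∀ q → partSize s q ≡ k) →
                         adjacentPairs s ≤ 5 * (k * k) + 10 * k
  adjacentPairs-balanced-bound ctf zero s empty = ≤-reflexive (begin
    adjacentPairs s                      ≡⟨ ∑V-cong (λ (p , i) → ∑V-cong λ w →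
                                      cong (λ b → 𝟙 (b ∧ s w ∧ adj G (p , i) w)) (partSize≡0⇒∉ s p (empty p) i)) ⟩
    ∑V {n} (λ _ → ∑V {n} (λ _ → 0))  ≡⟨ trans (∑V-cong {n} λ _ → ∑V-zero {n}) (∑V-zero {n}) ⟩
    0                            ∎)
    where open ≡-Reasoning
  adjacentPairs-balanced-bound ctf (suc k) s balanced with Balanced.low-degree-transversal G ctf s (suc k) balanced (s≤s z≤n)
  ... | J , J∈s , lowDeg = begin
    adjacentPairs s                                                   ≤⟨ adjacentPairs-∖ s (transversal J) ⟩
    adjacentPairs s′ + 2 * ∑V (λ v → 𝟙 (transversal J v) * deg s v)   ≡⟨ cong (λ d → adjacentPairs s′ + 2 * d) (∑V-transversal J (deg s)) ⟩
    adjacentPairs s′ + 2 * ∑[ q < 3 ] deg s (q , J q)                 ≤⟨ +-mono-≤ (adjacentPairs-balanced-bound ctf k s′ balanced′)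
                                                                          (*-monoʳ-≤ 2 lowDeg) ⟩
    5 * (k * k) + 10 * k + 2 * (5 * suc k)                    ≤⟨ m≤m+n _ 5 ⟩
    5 * (k * k) + 10 * k + 2 * (5 * suc k) + 5                ≡⟨ regroup k ⟩
    5 * (suc k * suc k) + 10 * suc k                          ∎
    where
    open ≤-Reasoning
    s′ = s ∖ transversal J
    balanced′ : ∀ q → partSize s′ q ≡ k
    balanced′ q = partSize-∖-transversal s J k q (J∈s q) (balanced q)
    regroup : ∀ k → 5 * (k * k) + 10 * k + 2 * (5 * suc k) + 5 ≡ 5 * (suc k * suc k) + 10 * suc k
    regroup = solve-∀

listSum : ∀ {A : Set} → (A → ℕ) → List A → ℕ
listSum f [] = 0
listSum f (x ∷ xs) = f x + listSum f xs

length-filter≡listSum-𝟙 : ∀ {A : Set} (P : A → Bool) xs →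
                          length (filter (λ x → P x Bool.≟ true) xs) ≡ listSum (𝟙 ∘ P) xs
length-filter≡listSum-𝟙 P [] = refl
length-filter≡listSum-𝟙 P (x ∷ xs) with P x
... | true = cong suc (length-filter≡listSum-𝟙 P xs)
... | false = length-filter≡listSum-𝟙 P xs

listSum-++ : ∀ {A : Set} (f : A → ℕ) xs ys → listSum f (xs ++ ys) ≡ listSum f xs + listSum f ys
listSum-++ f [] ys = refl
listSum-++ f (x ∷ xs) ys = trans (cong (f x +_) (listSum-++ f xs ys)) (sym (+-assoc (f x) _ _))

listSum-map : ∀ {A B : Set} (f : B → ℕ) (g : A → B) xs → listSum f (map g xs) ≡ listSum (f ∘ g) xs
listSum-map f g [] = refl
listSum-map f g (x ∷ xs) = cong (f (g x) +_) (listSum-map f g xs)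

listSum-cartesianProduct : ∀ {A B : Set} (f : A × B → ℕ) xs ys →
  listSum f (cartesianProduct xs ys) ≡ listSum (λ x → listSum (λ y → f (x , y)) ys) xs
listSum-cartesianProduct f [] ys = refl
listSum-cartesianProduct f (x ∷ xs) ys =
  trans (listSum-++ f (map (x ,_) ys) _) (cong₂ _+_ (listSum-map f (x ,_) ys) (listSum-cartesianProduct f xs ys))

listSum-tabulate : ∀ {A : Set} {n} (f : A → ℕ) (g : Fin n → A) → listSum f (tabulate g) ≡ ∑[ i < n ] f (g i)
listSum-tabulate {n = zero} f g = refl
listSum-tabulate {n = suc n} f g = cong (f (g zero) +_) (listSum-tabulate f (g ∘ suc))

listSum-allVertices : ∀ {n} (f : Vertex n → ℕ) → listSum f (allVertices n) ≡ ∑V f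
listSum-allVertices {n} f = begin
  listSum f (allVertices n)                                ≡⟨ listSum-cartesianProduct f (allFin 3) (allFin n) ⟩
  listSum (λ p → listSum (λ j → f (p , j)) (allFin n)) (allFin 3) ≡⟨ listSum-tabulate (λ p → listSum (λ j → f (p , j)) (allFin n)) (λ p → p) ⟩
  ∑[ p < 3 ] listSum (λ j → f (p , j)) (allFin n)          ≡⟨ sum-cong-≗ (λ p → listSum-tabulate (λ j → f (p , j)) (λ j → j)) ⟩
  ∑V f                                                     ∎
  where open ≡-Reasoning

numEdges≡∑V : ∀ {n} (G : Graph n) → numEdges G ≡ ∑V (λ u → ∑V λ v → 𝟙 (isEdge G (u , v)))
numEdges≡∑V {n} G = begin
  numEdges G
    ≡⟨ length-filter≡listSum-𝟙 (isEdge G) (cartesianProduct (allVertices n) (allVertices n)) ⟩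
  listSum (𝟙 ∘ isEdge G) (cartesianProduct (allVertices n) (allVertices n))
    ≡⟨ listSum-cartesianProduct (𝟙 ∘ isEdge G) (allVertices n) (allVertices n) ⟩
  listSum (λ u → listSum (λ v → 𝟙 (isEdge G (u , v))) (allVertices n)) (allVertices n)
    ≡⟨ listSum-allVertices (λ u → listSum (λ v → 𝟙 (isEdge G (u , v))) (allVertices n)) ⟩
  ∑V (λ u → listSum (λ v → 𝟙 (isEdge G (u , v))) (allVertices n))
    ≡⟨ ∑V-cong (λ u → listSum-allVertices λ v → 𝟙 (isEdge G (u , v))) ⟩
  ∑V (λ u → ∑V λ v → 𝟙 (isEdge G (u , v)))
    ∎
  where open ≡-Reasoning

isEdge-both≤adj : ∀ {n} (G : Graph n) u v → 𝟙 (isEdge G (u , v)) + 𝟙 (isEdge G (v , u)) ≤ 𝟙 (adj G u v)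
isEdge-both≤adj G u v with code u <? code v | code v <? code u
... | yes u<v | yes v<u = ⊥-elim (<-asym u<v v<u)
... | yes _ | no _ = ≤-reflexive (+-identityʳ _)
... | no _ | yes _ = ≤-reflexive (cong 𝟙 (Graph.sym G v u))
... | no _ | no _ = z≤n

twice-numEdges≤adjacentPairs : ∀ {n} (G : Graph n) → 2 * numEdges G ≤ Pairs.adjacentPairs G (λ _ → true)
twice-numEdges≤adjacentPairs {n} G = begin
  2 * numEdges G                                ≡⟨ cong (2 *_) (numEdges≡∑V G) ⟩
  E + (E + 0)                                   ≡⟨ cong (E +_) (trans (+-identityʳ E) (∑V-comm (λ u v → e u v))) ⟩
  E + ∑V (λ v → ∑V λ u → e u v)                 ≡⟨ trans (∑V-cong λ u → ∑V-distrib-+ (e u) (λ v → e v u))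
                                                         (∑V-distrib-+ (λ u → ∑V (e u)) (λ u → ∑V λ v → e v u)) ⟨
  ∑V (λ u → ∑V λ v → e u v + e v u)             ≤⟨ ∑V-mono-≤ (λ u → ∑V-mono-≤ λ v → isEdge-both≤adj G u v) ⟩
  Pairs.adjacentPairs G (λ _ → true)                    ∎
  where
  open ≤-Reasoning
  e : Vertex n → Vertex n → ℕ
  e u v = 𝟙 (isEdge G (u , v))
  E = ∑V (λ u → ∑V (e u))

theorem2p4 : (n : ℕ) (G : Graph n) → CyclicallyTriangleFree G →
    2 * numEdges G ≤ 5 * (n * n) + 10 * n
theorem2p4 n G ctf = begin
  2 * numEdges G               ≤⟨ twice-numEdges≤adjacentPairs G ⟩
  adjacentPairs (λ _ → true)           ≤⟨ adjacentPairs-balanced-bound ctf n (λ _ → true) (λ _ → sum-const-1 n) ⟩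
  5 * (n * n) + 10 * n         ∎
  where
  open ≤-Reasoning
  open Pairs G
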